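{- For every positive integer $n$ and every integer $q \geq 2$, \[ q^{ -2^n + n + 1} \;\leq\; \mathbb{I}(Z_n,q) \;\leq\; \prod_{j = 1}^{n-1} \frac{1}{q^{(2^j-1)} - 1}, \] where the empty product (for $n=1$) equals $1$.
   Context: A word over an alphabet $\Sigma$ is a finite string of letters of $\Sigma$; $[q]=\{1,\dots,q\}$. A homomorphism $\phi$ of free monoids is nonerasing if no letter is mapped to the empty word. A word $U$ is an instance of a word $V$ if $U=\phi(V)$ for some nonerasing homomorphism $\phi$ from the free monoid on the letters of $V$ to words over the relevant alphabet. The Zimin words are defined by $Z_0=\varepsilon$ (empty word) and $Z_{n+1}=Z_n x_n Z_n$ with $x_n$ a new letter; so $Z_1=a$, $Z_2=aba$, $Z_3=abacaba$. For a word $V$, $\mathbb{I}_n(V,q)$ denotes the probability that a uniformly random word in $[q]^n$ is an instance of $V$, and $\mathbb{I}(V,q)=\lim_{n\to\infty}\mathbb{I}_n(V,q)$ (this limit is known to exist for every word $V$). -}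

module Defs where

open import Data.Nat as ℕ using (ℕ; zero; suc; _≤_; _∸_; _^_; _*_; NonZero)
import Data.Nat.Properties as ℕP
open import Data.Fin using (Fin; inject₁; fromℕ)
open import Data.List using (List; []; _∷_; _++_; [_]; map; concatMap; filter; length; allFin)
open import Data.Product using (Σ; ∃; ∃-syntax; _×_; _,_)
open import Relation.Binary.PropositionalEquality using (_≡_; _≢_)
open import Relation.Nullary using (Dec)
open import Data.Integer using (+_)
open import Data.Rational as ℚ using (ℚ; _/_; 0ℚ; _-_; _+_; _<_)
  renaming (_≤_ to _≤ℚ_)

Word : ℕ → Set
Word q = List (Fin q)

words : (q m : ℕ) → List (Word q)
words q zero    = [] ∷ []
words q (suc m) = concatMap (λ a → map (a ∷_) (words q m)) (allFin q)

-- Zimin words: Z 0 = ε, Z (n+1) = Z n · x_n · Z n, on the alphabet Fin n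
-- (letter x_k is the element k of Fin n).
Z : (n : ℕ) → List (Fin n)
Z zero    = []
Z (suc n) = map inject₁ (Z n) ++ [ fromℕ n ] ++ map inject₁ (Z n)

-- W is an instance of V: W = φ(V) for a nonerasing homomorphism φ,
-- given by the images φ i of the letters i (each nonempty).
IsInstance : {k q : ℕ} → List (Fin k) → Word q → Set
IsInstance {k} {q} V W =
  Σ (Fin k → Word q) λ φ → ((i : Fin k) → φ i ≢ []) × (concatMap φ V ≡ W)

-- Decision procedures for instance-hood of V (any one of them; the resulting
-- counts do not depend on the choice).
InstanceDecider : {k : ℕ} → List (Fin k) → ℕ → Set
InstanceDecider V q = (W : Word q) → Dec (IsInstance V W)

countInstances : {k : ℕ} (V : List (Fin k)) (q : ℕ) → InstanceDecider V q → ℕ → ℕ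
countInstances V q dec m = length (filter dec (words q m))

nonZero-q : (q : ℕ) → 2 ≤ q → NonZero q
nonZero-q q h = ℕ.>-nonZero (ℕP.≤-trans (ℕ.s≤s ℕ.z≤n) h)

I_ : {k : ℕ} (V : List (Fin k)) (q : ℕ) → 2 ≤ q → InstanceDecider V q → ℕ → ℚ
I_ V q h dec m =
  _/_ (+ countInstances V q dec m) (q ^ m) {{ℕP.m^n≢0 q m {{nonZero-q q h}}}}

-- Statements about the limit of a sequence of rationals (the limit is known
-- to exist): L ≤ lim s  and  lim s ≤ U.
LimGeq : (ℕ → ℚ) → ℚ → Set
LimGeq s L = (ε : ℚ) → 0ℚ < ε → ∃[ N ] ((m : ℕ) → N ≤ m → L - ε ≤ℚ s m)

LimLeq : (ℕ → ℚ) → ℚ → Set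
LimLeq s U = (ε : ℚ) → 0ℚ < ε → ∃[ N ] ((m : ℕ) → N ≤ m → s m ≤ℚ U + ε)

-- Lower bound q^{-2^n+n+1} = 1 / q^{2^n - n - 1}  (note 2^n ≥ n+1).
lowerBound : (q : ℕ) → 2 ≤ q → ℕ → ℚ
lowerBound q h n = _/_ (+ 1) (q ^ (2 ^ n ∸ n ∸ 1)) {{ℕP.m^n≢0 q (2 ^ n ∸ n ∸ 1) {{nonZero-q q h}}}}

prodFrom : (q : ℕ) → (j r : ℕ) → ℕ     -- ∏_{i=j}^{j+r-1}
prodFrom q j zero    = 1
prodFrom q j (suc r) = (q ^ (2 ^ j ∸ 1) ∸ 1) * prodFrom q (suc j) r

D : ℕ → ℕ → ℕ
D q n = prodFrom q 1 (n ∸ 1)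

factor-pos : (q j : ℕ) → 2 ≤ q → 1 ≤ j → NonZero (q ^ (2 ^ j ∸ 1) ∸ 1)
factor-pos q j h hj = ℕ.>-nonZero (ℕP.∸-monoˡ-≤ 1 (ℕP.≤-trans h q≤))
  where
  instance _ = nonZero-q q h
  e≥1 : 1 ≤ 2 ^ j ∸ 1
  e≥1 = ℕP.∸-monoˡ-≤ 1 (ℕP.≤-trans (ℕP.≤-reflexive refl2) (ℕP.^-monoʳ-≤ 2 hj))
    where
    open import Relation.Binary.PropositionalEquality using (refl)
    refl2 : 2 ≡ 2 ^ 1
    refl2 = refl
  q≤ : q ≤ q ^ (2 ^ j ∸ 1)
  q≤ = ℕP.≤-trans (ℕP.≤-reflexive (sym (ℕP.*-identityʳ q))) (ℕP.^-monoʳ-≤ q e≥1)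
    where open import Relation.Binary.PropositionalEquality using (sym)

prodFrom-pos : (q j r : ℕ) → 2 ≤ q → 1 ≤ j → NonZero (prodFrom q j r)
prodFrom-pos q j zero h hj = _
prodFrom-pos q j (suc r) h hj =
  ℕP.m*n≢0 _ _ {{factor-pos q j h hj}} {{prodFrom-pos q (suc j) r h (ℕP.m≤n⇒m≤1+n hj)}}

upperBound : (q : ℕ) → 2 ≤ q → ℕ → ℚ
upperBound q h n = _/_ (+ 1) (D q n) {{prodFrom-pos q 1 (n ∸ 1) h (ℕ.s≤s ℕ.z≤n)}}

module Submission where

-- Both bounds in fact hold for every length m large
-- enough, so the statements about the limit follow at once.
--
-- Writing Zₙ₊₁ = x₀ y₁ x₀ y₂ ⋯ x₀ with y = Zₙ on the
-- remaining variables, an instance φ(Zₙ₊₁) whose variables are all preceded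
-- by a fixed word p has the form V · p · u with u = φ(x₀) and V an instance
-- of Zₙ with prefix p u p.  Enumerating u by its length ℓ gives an explicit
-- list of candidates of length m whose size S(n, |p|, m) satisfies
--   S · ∏_{j=1}^{n} (q^(2^j-1) - 1) · q^((2^(n+1)-1)|p|) ≤ q^m ;
-- the factor q^(2^(n+1)-1) - 1 is produced by the geometric series over ℓ.
-- Taking p empty bounds the number of length-m instances of Zₙ₊₁.
--
-- The words A M A, where A is one of the q^k instances of Zₖ
-- mapping every variable to a single letter and M is any nonempty word, are
-- distinct instances of Zₖ₊₁; for length m ≥ 2^(k+1) there are at least
-- q^(m - 2^(k+1) + k + 2) of them.

open import Defs
open import Data.Nat using (ℕ; zero; suc; _+_; _*_; _∸_; _^_; _≤_; _<_; z≤n; s≤s; _<?_; NonZero; >-nonZero)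
open import Data.Nat.Properties
open import Data.Nat.Tactic.RingSolver using (solve-∀)
open import Data.Fin using (Fin; zero; suc; inject₁; fromℕ)
open import Data.List using (List; []; _∷_; _++_; [_]; map; concatMap; filter; length; allFin; cartesianProductWith; cartesianProduct)
open import Data.List.Properties using (length-++; length-map; length-tabulate; ++-assoc; ++-identityʳ; map-++; ∷-injective; ++-cancelʳ; concatMap-++; concatMap-map; map-concatMap; concatMap-cong)
open import Data.List.Membership.Propositional using (_∈_)
open import Data.List.Membership.Propositional.Properties
open import Data.List.Relation.Unary.Any using (here; there)
import Data.List.Relation.Unary.Any as Any
import Data.List.Relation.Unary.All as All
open import Data.List.Relation.Unary.All using ([]; _∷_)
import Data.List.Relation.Unary.All.Properties as All
open import Data.List.Relation.Unary.AllPairs using ([]; _∷_)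
open import Data.List.Relation.Unary.Unique.Propositional using (Unique)
import Data.List.Relation.Unary.Unique.Propositional.Properties as Unique
open import Data.Product using (∃₂; _×_; _,_; proj₁)
open import Data.Sum using (inj₁; inj₂)
open import Data.Empty using (⊥-elim)
open import Relation.Nullary using (yes; no)
open import Relation.Binary.PropositionalEquality hiding ([_])
import Data.Integer as ℤ
import Data.Integer.Properties as ℤP
open import Data.Rational as ℚ using (ℚ; _/_; _-_) renaming (_≤_ to _≤ℚ_; _+_ to _+ℚ_)
import Data.Rational.Properties as ℚP
import Data.Rational.Unnormalised as ℚᵘ
import Data.Rational.Unnormalised.Properties as ℚᵘP

length-concatMap-≤ : ∀ {A B : Set} (f : A → List B) (xs : List A) (K bound : ℕ) →
  (∀ {x} → x ∈ xs → length (f x) * K ≤ bound) →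
  length (concatMap f xs) * K ≤ length xs * bound
length-concatMap-≤ f [] K bound small = z≤n
length-concatMap-≤ f (x ∷ xs) K bound small = begin
  length (f x ++ concatMap f xs) * K
    ≡⟨ cong (_* K) (length-++ (f x)) ⟩
  (length (f x) + length (concatMap f xs)) * K
    ≡⟨ *-distribʳ-+ K (length (f x)) _ ⟩
  length (f x) * K + length (concatMap f xs) * K
    ≤⟨ +-mono-≤ (small (here refl)) (length-concatMap-≤ f xs K bound (λ x∈ → small (there x∈))) ⟩
  bound + length xs * bound ∎
  where open ≤-Reasoning

concatMap-concatMap : ∀ {A B C : Set} (f : B → List C) (g : A → List B) (xs : List A) →
  concatMap f (concatMap g xs) ≡ concatMap (λ x → concatMap f (g x)) xs
concatMap-concatMap f g [] = refl
concatMap-concatMap f g (x ∷ xs) =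
  trans (concatMap-++ f (g x) _) (cong (concatMap f (g x) ++_) (concatMap-concatMap f g xs))

concatMap≡cartesianProductWith : ∀ {A B C : Set} (f : A → B → C) (xs : List A) (ys : List B) →
  concatMap (λ x → map (f x) ys) xs ≡ cartesianProductWith f xs ys
concatMap≡cartesianProductWith f [] ys = refl
concatMap≡cartesianProductWith f (x ∷ xs) ys = cong (map (f x) ys ++_) (concatMap≡cartesianProductWith f xs ys)

length-cartesianProductWith : ∀ {A B C : Set} (f : A → B → C) (xs : List A) (ys : List B) →
  length (cartesianProductWith f xs ys) ≡ length xs * length ys
length-cartesianProductWith f [] ys = refl
length-cartesianProductWith f (x ∷ xs) ys = begin
  length (map (f x) ys ++ cartesianProductWith f xs ys)
    ≡⟨ length-++ (map (f x) ys) ⟩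
  length (map (f x) ys) + length (cartesianProductWith f xs ys)
    ≡⟨ cong₂ _+_ (length-map (f x) ys) (length-cartesianProductWith f xs ys) ⟩
  length ys + length xs * length ys ∎
  where open ≡-Reasoning

unique-⊆-length : ∀ {A : Set} (xs ys : List A) → Unique xs →
  (∀ {x} → x ∈ xs → x ∈ ys) → length xs ≤ length ys
unique-⊆-length [] ys _ _ = z≤n
unique-⊆-length (x ∷ xs) ys (x∉xs ∷ unique) xs⊆ys with ∈-∃++ (xs⊆ys (here refl))
... | ys₁ , ys₂ , refl = begin
  suc (length xs)               ≤⟨ s≤s (unique-⊆-length xs (ys₁ ++ ys₂) unique xs⊆ys₁ys₂) ⟩
  suc (length (ys₁ ++ ys₂))     ≡⟨ cong suc (length-++ ys₁) ⟩
  suc (length ys₁ + length ys₂) ≡⟨ +-suc (length ys₁) (length ys₂) ⟨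
  length ys₁ + suc (length ys₂) ≡⟨ length-++ ys₁ ⟨
  length (ys₁ ++ x ∷ ys₂)       ∎
  where
  open ≤-Reasoning
  xs⊆ys₁ys₂ : ∀ {z} → z ∈ xs → z ∈ ys₁ ++ ys₂
  xs⊆ys₁ys₂ z∈xs with ∈-++⁻ ys₁ (xs⊆ys (there z∈xs))
  ... | inj₁ z∈ys₁         = ∈-++⁺ˡ z∈ys₁
  ... | inj₂ (here refl)   = ⊥-elim (All.lookup x∉xs z∈xs refl)
  ... | inj₂ (there z∈ys₂) = ∈-++⁺ʳ ys₁ z∈ys₂

unique-map : ∀ {A B : Set} (f : A → B) (xs : List A) → Unique xs →
  (∀ {x y} → x ∈ xs → y ∈ xs → f x ≡ f y → x ≡ y) → Unique (map f xs)
unique-map f [] _ _ = []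
unique-map f (x ∷ xs) (x∉xs ∷ unique) injective =
  All.map⁺ (All.tabulate (λ y∈xs fx≡fy → All.lookup x∉xs y∈xs (injective (here refl) (there y∈xs) fx≡fy)))
  ∷ unique-map f xs unique (λ x∈ y∈ → injective (there x∈) (there y∈))

++-cancel-equal-length : ∀ {A : Set} (xs ys us vs : List A) → length xs ≡ length ys →
  xs ++ us ≡ ys ++ vs → xs ≡ ys × us ≡ vs
++-cancel-equal-length [] [] us vs _ eq = refl , eq
++-cancel-equal-length (x ∷ xs) (y ∷ ys) us vs same-length eq with ∷-injective eq
... | refl , eq′ with ++-cancel-equal-length xs ys us vs (suc-injective same-length) eq′
... | refl , us≡vs = refl , us≡vs

nonempty⇒length≥1 : ∀ {A : Set} (xs : List A) → xs ≢ [] → 1 ≤ length xs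
nonempty⇒length≥1 []      xs≢[] = ⊥-elim (xs≢[] refl)
nonempty⇒length≥1 (_ ∷ _) _     = s≤s z≤n

module _ {q : ℕ} where

  words-suc : ∀ m → words q (suc m) ≡ cartesianProductWith _∷_ (allFin q) (words q m)
  words-suc m = concatMap≡cartesianProductWith _∷_ (allFin q) (words q m)

  length-words : ∀ m → length (words q m) ≡ q ^ m
  length-words zero = refl
  length-words (suc m) = begin
    length (words q (suc m))
      ≡⟨ cong length (words-suc m) ⟩
    length (cartesianProductWith _∷_ (allFin q) (words q m))
      ≡⟨ length-cartesianProductWith _∷_ (allFin q) (words q m) ⟩
    length (allFin q) * length (words q m)
      ≡⟨ cong₂ _*_ (length-tabulate {n = q} (λ i → i)) (length-words m) ⟩
    q * q ^ m ∎
    where open ≡-Reasoning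

  ∈words⇒length : ∀ m {W : Word q} → W ∈ words q m → length W ≡ m
  ∈words⇒length zero (here refl) = refl
  ∈words⇒length (suc m) W∈
    with ∈-cartesianProductWith⁻ _∷_ (allFin q) (words q m) (subst (_ ∈_) (words-suc m) W∈)
  ... | _ , V , _ , V∈ , refl = cong suc (∈words⇒length m V∈)

  ∈words : (W : Word q) → W ∈ words q (length W)
  ∈words [] = here refl
  ∈words (a ∷ W) = subst (a ∷ W ∈_) (sym (words-suc (length W)))
    (∈-cartesianProductWith⁺ _∷_ (∈-allFin a) (∈words W))

  words-unique : ∀ m → Unique (words q m)
  words-unique zero = [] ∷ []
  words-unique (suc m) = subst Unique (sym (words-suc m))
    (Unique.cartesianProductWith⁺ _∷_ ∷-injective (Unique.allFin⁺ q) (words-unique m))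

-- Extending an assignment of the variables of Zₖ by a value t for the new
-- middle variable xₖ, the top element of Fin (k+1).
extend : ∀ {k} {T : Set} → (Fin k → T) → T → Fin (suc k) → T
extend {zero}  f t zero    = t
extend {suc k} f t zero    = f zero
extend {suc k} f t (suc i) = extend (λ j → f (suc j)) t i

extend-inject₁ : ∀ {k} {T : Set} (f : Fin k → T) (t : T) (i : Fin k) → extend f t (inject₁ i) ≡ f i
extend-inject₁ {suc k} f t zero    = refl
extend-inject₁ {suc k} f t (suc i) = extend-inject₁ (λ j → f (suc j)) t i

extend-fromℕ : ∀ {k} {T : Set} (f : Fin k → T) (t : T) → extend f t (fromℕ k) ≡ t
extend-fromℕ {zero}  f t = refl
extend-fromℕ {suc k} f t = extend-fromℕ (λ j → f (suc j)) t

extend-all : ∀ {k} {T : Set} (P : T → Set) (f : Fin k → T) (t : T) →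
  (∀ i → P (f i)) → P t → ∀ i → P (extend f t i)
extend-all {zero}  P f t Pf Pt zero    = Pt
extend-all {suc k} P f t Pf Pt zero    = Pf zero
extend-all {suc k} P f t Pf Pt (suc i) = extend-all P (λ j → f (suc j)) t (λ j → Pf (suc j)) Pt i

sandwich-instance : ∀ {q} k {A M : Word q} → IsInstance (Z k) A → M ≢ [] →
  IsInstance (Z (suc k)) (A ++ M ++ A)
sandwich-instance k {M = M} (φ , φ-nonerasing , refl) M≢[] =
  φ′ , extend-all (_≢ []) φ M φ-nonerasing M≢[] , image
  where
  open ≡-Reasoning
  φ′ = extend φ M
  image-Zk : concatMap φ′ (map inject₁ (Z k)) ≡ concatMap φ (Z k)
  image-Zk = trans (concatMap-map φ′ inject₁ (Z k)) (concatMap-cong (extend-inject₁ φ M) (Z k))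
  image : concatMap φ′ (Z (suc k)) ≡ concatMap φ (Z k) ++ M ++ concatMap φ (Z k)
  image = begin
    concatMap φ′ (map inject₁ (Z k) ++ [ fromℕ k ] ++ map inject₁ (Z k))
      ≡⟨ concatMap-++ φ′ (map inject₁ (Z k)) _ ⟩
    concatMap φ′ (map inject₁ (Z k)) ++ φ′ (fromℕ k) ++ concatMap φ′ (map inject₁ (Z k))
      ≡⟨ cong₂ (λ a b → a ++ b ++ a) image-Zk (extend-fromℕ φ M) ⟩
    concatMap φ (Z k) ++ M ++ concatMap φ (Z k) ∎

x₀-then : ∀ {n} → Fin n → List (Fin (suc n))
x₀-then y = zero ∷ suc y ∷ []

Z-interleave : ∀ n → Z (suc n) ≡ concatMap x₀-then (Z n) ++ [ zero ]
Z-interleave zero = refl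
Z-interleave (suc k) = begin
  map inject₁ (Z (suc k)) ++ [ fromℕ (suc k) ] ++ map inject₁ (Z (suc k))
    ≡⟨ cong (λ w → w ++ [ fromℕ (suc k) ] ++ w) inject-Z ⟩
  (C ++ [ zero ]) ++ [ fromℕ (suc k) ] ++ (C ++ [ zero ])
    ≡⟨ ++-assoc C [ zero ] _ ⟩
  C ++ ((x₀-then (fromℕ k) ++ C) ++ [ zero ])
    ≡⟨ ++-assoc C (x₀-then (fromℕ k) ++ C) [ zero ] ⟨
  (C ++ x₀-then (fromℕ k) ++ C) ++ [ zero ]
    ≡⟨ cong (_++ [ zero ]) interleave-Z ⟨
  concatMap x₀-then (Z (suc k)) ++ [ zero ] ∎
  where
  open ≡-Reasoning
  C = concatMap (λ y → x₀-then (inject₁ y)) (Z k)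
  inject-Z : map inject₁ (Z (suc k)) ≡ C ++ [ zero ]
  inject-Z = begin
    map inject₁ (Z (suc k))
      ≡⟨ cong (map inject₁) (Z-interleave k) ⟩
    map inject₁ (concatMap x₀-then (Z k) ++ [ zero ])
      ≡⟨ map-++ inject₁ (concatMap x₀-then (Z k)) _ ⟩
    map inject₁ (concatMap x₀-then (Z k)) ++ [ zero ]
      ≡⟨ cong (_++ [ zero ]) (map-concatMap inject₁ x₀-then (Z k)) ⟩
    C ++ [ zero ] ∎
  interleave-Z : concatMap x₀-then (Z (suc k)) ≡ C ++ x₀-then (fromℕ k) ++ C
  interleave-Z = begin
    concatMap x₀-then (map inject₁ (Z k) ++ [ fromℕ k ] ++ map inject₁ (Z k))
      ≡⟨ concatMap-++ x₀-then (map inject₁ (Z k)) _ ⟩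
    concatMap x₀-then (map inject₁ (Z k)) ++ x₀-then (fromℕ k) ++ concatMap x₀-then (map inject₁ (Z k))
      ≡⟨ cong (λ w → w ++ x₀-then (fromℕ k) ++ w) (concatMap-map x₀-then inject₁ (Z k)) ⟩
    C ++ x₀-then (fromℕ k) ++ C ∎

prefixed : ∀ {k q} → Word q → (Fin k → Word q) → List (Fin k) → Word q
prefixed p φ w = concatMap (λ x → p ++ φ x) w

-- Reading Zₙ₊₁ as x₀ y₁ x₀ ⋯ y_{2ⁿ-1} x₀ and grouping p φ(x₀) p φ(yᵢ):
-- with u = φ(x₀), the p-prefixed image of Zₙ₊₁ is the (p u p)-prefixed
-- image of Zₙ under φ(x₁) … φ(xₙ), followed by p u.
prefixed-Z-decompose : ∀ {q} n (p : Word q) (φ : Fin (suc n) → Word q) →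
  prefixed p φ (Z (suc n)) ≡
  prefixed (p ++ φ zero ++ p) (λ y → φ (suc y)) (Z n) ++ p ++ φ zero
prefixed-Z-decompose n p φ = begin
  concatMap f (Z (suc n))
    ≡⟨ cong (concatMap f) (Z-interleave n) ⟩
  concatMap f (concatMap x₀-then (Z n) ++ [ zero ])
    ≡⟨ concatMap-++ f (concatMap x₀-then (Z n)) _ ⟩
  concatMap f (concatMap x₀-then (Z n)) ++ (f zero ++ [])
    ≡⟨ cong₂ _++_ (concatMap-concatMap f x₀-then (Z n)) (++-identityʳ (f zero)) ⟩
  concatMap (λ y → concatMap f (x₀-then y)) (Z n) ++ f zero
    ≡⟨ cong (_++ f zero) (concatMap-cong regroup (Z n)) ⟩
  prefixed (p ++ φ zero ++ p) (λ y → φ (suc y)) (Z n) ++ p ++ φ zero ∎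
  where
  open ≡-Reasoning
  f = λ x → p ++ φ x
  regroup : ∀ y → concatMap f (x₀-then y) ≡ (p ++ φ zero ++ p) ++ φ (suc y)
  regroup y = begin
    (p ++ φ zero) ++ (p ++ φ (suc y)) ++ [] ≡⟨ cong ((p ++ φ zero) ++_) (++-identityʳ _) ⟩
    (p ++ φ zero) ++ p ++ φ (suc y)         ≡⟨ ++-assoc p (φ zero) _ ⟩
    p ++ φ zero ++ p ++ φ (suc y)           ≡⟨ cong (p ++_) (++-assoc (φ zero) p _) ⟨
    p ++ (φ zero ++ p) ++ φ (suc y)         ≡⟨ ++-assoc p _ _ ⟨
    (p ++ φ zero ++ p) ++ φ (suc y)         ∎

blocks : ∀ {A : Set} → (ℕ → List A) → ℕ → List A
blocks f zero    = []
blocks f (suc L) = blocks f L ++ f (suc L)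

∈-blocks : ∀ {A : Set} (f : ℕ → List A) {x : A} ℓ L → 1 ≤ ℓ → ℓ ≤ L → x ∈ f ℓ → x ∈ blocks f L
∈-blocks f _ zero (s≤s _) () _
∈-blocks f ℓ (suc L) 1≤ℓ ℓ≤1+L x∈ with m≤n⇒m<n∨m≡n ℓ≤1+L
... | inj₁ ℓ<1+L = ∈-++⁺ˡ (∈-blocks f ℓ L 1≤ℓ (≤-pred ℓ<1+L) x∈)
... | inj₂ refl  = ∈-++⁺ʳ (blocks f L) x∈

geometric-step : ∀ a b Q P X → a + X ≤ P * X → b + X ≤ Q * X → a * Q + b + X ≤ (Q * P) * X
geometric-step a b Q P X a+X≤PX b+X≤QX = +-cancelʳ-≤ (Q * X) _ _ (begin
  a * Q + b + X + Q * X   ≡⟨ regroup a b Q X ⟩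
  (a + X) * Q + (b + X)   ≤⟨ +-mono-≤ (*-monoˡ-≤ Q a+X≤PX) b+X≤QX ⟩
  P * X * Q + Q * X       ≡⟨ cong (_+ Q * X) (rotate P X Q) ⟩
  (Q * P) * X + Q * X     ∎)
  where
  open ≤-Reasoning
  regroup : ∀ a b Q X → a * Q + b + X + Q * X ≡ (a + X) * Q + (b + X)
  regroup = solve-∀
  rotate : ∀ P X Q → P * X * Q ≡ (Q * P) * X
  rotate = solve-∀

blocks-geometric : ∀ {A : Set} (f : ℕ → List A) (K Q X L : ℕ) → 1 ≤ Q →
  (∀ ℓ → 1 ≤ ℓ → ℓ ≤ L → length (f ℓ) * K * Q ^ ℓ ≤ X) →
  length (blocks f L) * ((Q ∸ 1) * K) ≤ X
blocks-geometric f K Q X L 1≤Q small = *-cancelˡ-≤ (Q ^ L) {{m^n≢0 Q L {{>-nonZero 1≤Q}}}} (begin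
  Q ^ L * (length (blocks f L) * c) ≡⟨ *-comm (Q ^ L) _ ⟩
  length (blocks f L) * c * Q ^ L   ≤⟨ m≤m+n _ X ⟩
  length (blocks f L) * c * Q ^ L + X ≤⟨ partial L ≤-refl ⟩
  Q ^ L * X ∎)
  where
  open ≤-Reasoning
  c = (Q ∸ 1) * K
  -- Multiplying the hypothesis by Q - 1 and adding X.
  block : ∀ ℓ → 1 ≤ ℓ → ℓ ≤ L → length (f ℓ) * c * Q ^ ℓ + X ≤ Q * X
  block ℓ 1≤ℓ ℓ≤L = begin
    length (f ℓ) * c * Q ^ ℓ + X       ≡⟨ cong (_+ X) (pull (length (f ℓ)) (Q ∸ 1) K (Q ^ ℓ)) ⟩
    (Q ∸ 1) * (length (f ℓ) * K * Q ^ ℓ) + X ≤⟨ +-monoˡ-≤ X (*-monoʳ-≤ (Q ∸ 1) (small ℓ 1≤ℓ ℓ≤L)) ⟩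
    (Q ∸ 1) * X + X                    ≡⟨ *-suc-distrib (Q ∸ 1) X ⟩
    (Q ∸ 1 + 1) * X                    ≡⟨ cong (_* X) (m∸n+n≡m 1≤Q) ⟩
    Q * X                              ∎
    where
    pull : ∀ b d K R → b * (d * K) * R ≡ d * (b * K * R)
    pull = solve-∀
    *-suc-distrib : ∀ d X → d * X + X ≡ (d + 1) * X
    *-suc-distrib = solve-∀
  partial : ∀ L′ → L′ ≤ L → length (blocks f L′) * c * Q ^ L′ + X ≤ Q ^ L′ * X
  partial zero    _      = ≤-reflexive (sym (*-identityˡ X))
  partial (suc L′) 1+L′≤L = subst (_≤ Q * Q ^ L′ * X) (sym split)
    (geometric-step a b Q (Q ^ L′) X (partial L′ (≤-trans (n≤1+n L′) 1+L′≤L)) (block (suc L′) (s≤s z≤n) 1+L′≤L))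
    where
    a = length (blocks f L′) * c * Q ^ L′
    b = length (f (suc L′)) * c * Q ^ suc L′
    distribute : ∀ S B c Q P → (S + B) * c * (Q * P) ≡ S * c * P * Q + B * c * (Q * P)
    distribute = solve-∀
    split : length (blocks f L′ ++ f (suc L′)) * c * Q ^ suc L′ + X ≡ a * Q + b + X
    split = cong (_+ X) (trans (cong (λ t → t * c * Q ^ suc L′) (length-++ (blocks f L′)))
      (distribute (length (blocks f L′)) (length (f (suc L′))) c Q (Q ^ L′)))

prodFrom-snoc : ∀ q j r → prodFrom q j (suc r) ≡ prodFrom q j r * (q ^ (2 ^ (j + r) ∸ 1) ∸ 1)
prodFrom-snoc q j zero rewrite +-identityʳ j = trans (*-identityʳ _) (sym (*-identityˡ _))
prodFrom-snoc q j (suc r) = begin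
  f j * prodFrom q (suc j) (suc r)             ≡⟨ cong (f j *_) (prodFrom-snoc q (suc j) r) ⟩
  f j * (prodFrom q (suc j) r * f (suc j + r)) ≡⟨ *-assoc (f j) _ _ ⟨
  f j * prodFrom q (suc j) r * f (suc j + r)   ≡⟨ cong (λ i → f j * prodFrom q (suc j) r * f i) (+-suc j r) ⟨
  f j * prodFrom q (suc j) r * f (j + suc r)   ∎
  where
  open ≡-Reasoning
  f = λ i → q ^ (2 ^ i ∸ 1) ∸ 1

2^suc∸1 : ∀ k → 2 ^ suc k ∸ 1 ≡ (2 ^ k ∸ 1) + (2 ^ k ∸ 1) + 1
2^suc∸1 k with 2 ^ k | m^n>0 2 k
... | suc t | _ = double t
  where
  double : ∀ t → t + suc (t + 0) ≡ t + t + 1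
  double = solve-∀

module _ {q : ℕ} where

  mutual
    -- candidates n p m contains every length-m word prefixed p φ (Z (n+1))
    -- with φ nonerasing (see candidates-cover).  For n + 1 = 1 these are the
    -- words p u with u nonempty; otherwise they are sorted by ℓ = |φ(x₀)|.
    candidates : ℕ → Word q → ℕ → List (Word q)
    candidates zero p m with length p <? m
    ... | yes _ = map (p ++_) (words q (m ∸ length p))
    ... | no _  = []
    candidates (suc n) p m = blocks (candidates-with-first n p m) (m ∸ length p)

    -- The candidates V p u with |u| = ℓ and V a candidate for the prefix p u p
    -- (following prefixed-Z-decompose).
    candidates-with-first : ℕ → Word q → ℕ → ℕ → List (Word q)
    candidates-with-first n p m ℓ =
      concatMap (λ u → map (λ V → V ++ p ++ u) (candidates n (p ++ u ++ p) (m ∸ (length p + ℓ)))) (words q ℓ)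

  -- Z₁ = x₀, so its p-prefixed image is p φ(x₀).
  length-prefixed-Z₁ : ∀ (p : Word q) (φ : Fin 1 → Word q) {m} →
    length (prefixed p φ (Z 1)) ≡ m → length p + length (φ zero) ≡ m
  length-prefixed-Z₁ p φ len = trans (sym (length-++ p)) (trans (cong length (sym (++-identityʳ (p ++ φ zero)))) len)

  candidates-cover : ∀ n (p : Word q) (φ : Fin (suc n) → Word q) → (∀ i → φ i ≢ []) →
    ∀ m → length (prefixed p φ (Z (suc n))) ≡ m → prefixed p φ (Z (suc n)) ∈ candidates n p m
  candidates-cover zero p φ nonerasing m len with length p <? m
  ... | yes _ = subst (_∈ map (p ++_) (words q (m ∸ length p))) (sym (++-identityʳ (p ++ φ zero)))
                  (∈-map⁺ (p ++_) (subst (λ k → φ zero ∈ words q k) |u|≡m∸|p| (∈words (φ zero))))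
    where
    |u|≡m∸|p| : length (φ zero) ≡ m ∸ length p
    |u|≡m∸|p| = sym (trans (cong (_∸ length p) (sym (length-prefixed-Z₁ p φ len))) (m+n∸m≡n (length p) _))
  ... | no |p|≮m = ⊥-elim (|p|≮m (subst (length p <_) (length-prefixed-Z₁ p φ len)
                     (m<m+n (length p) (nonempty⇒length≥1 (φ zero) (nonerasing zero)))))
  candidates-cover (suc n) p φ nonerasing m len rewrite prefixed-Z-decompose (suc n) p φ =
    ∈-blocks (candidates-with-first n p m) ℓ (m ∸ length p) (nonempty⇒length≥1 u (nonerasing zero)) ℓ≤m∸|p| V·p·u∈
    where
    u  = φ zero
    ℓ  = length u
    V  = prefixed (p ++ u ++ p) (λ y → φ (suc y)) (Z (suc n))
    |V|+|p|+ℓ≡m : length V + (length p + ℓ) ≡ m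
    |V|+|p|+ℓ≡m = trans (cong (length V +_) (sym (length-++ p))) (trans (sym (length-++ V)) len)
    ℓ≤m∸|p| : ℓ ≤ m ∸ length p
    ℓ≤m∸|p| = m+n≤o⇒m≤o∸n ℓ (subst (_≤ m) (+-comm (length p) ℓ)
                (subst (length p + ℓ ≤_) |V|+|p|+ℓ≡m (m≤n+m (length p + ℓ) (length V))))
    |V|≡ : length V ≡ m ∸ (length p + ℓ)
    |V|≡ = sym (trans (cong (_∸ (length p + ℓ)) (sym |V|+|p|+ℓ≡m)) (m+n∸n≡m (length V) (length p + ℓ)))
    V∈ : V ∈ candidates n (p ++ u ++ p) (m ∸ (length p + ℓ))
    V∈ = candidates-cover n (p ++ u ++ p) (λ y → φ (suc y)) (λ i → nonerasing (suc i)) _ |V|≡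
    V·p·u∈ : V ++ p ++ u ∈ candidates-with-first n p m ℓ
    V·p·u∈ = ∈-concatMap⁺ (λ u′ → map (λ W → W ++ p ++ u′) (candidates n (p ++ u′ ++ p) (m ∸ (length p + ℓ))))
      (Any.map (λ { refl → ∈-map⁺ (λ W → W ++ p ++ u) V∈ }) (∈words u))

exponent-split : ∀ q E s ℓ → q ^ ((E + E + 1) * s) * (q ^ E) ^ ℓ ≡ q ^ (E * (s + (ℓ + s))) * q ^ s
exponent-split q E s ℓ = begin
  q ^ ((E + E + 1) * s) * (q ^ E) ^ ℓ  ≡⟨ cong (q ^ ((E + E + 1) * s) *_) (^-*-assoc q E ℓ) ⟩
  q ^ ((E + E + 1) * s) * q ^ (E * ℓ)  ≡⟨ ^-distribˡ-+-* q ((E + E + 1) * s) (E * ℓ) ⟨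
  q ^ ((E + E + 1) * s + E * ℓ)        ≡⟨ cong (q ^_) (expand E s ℓ) ⟩
  q ^ (E * (s + (ℓ + s)) + s)          ≡⟨ ^-distribˡ-+-* q (E * (s + (ℓ + s))) s ⟩
  q ^ (E * (s + (ℓ + s))) * q ^ s      ∎
  where
  open ≡-Reasoning
  expand : ∀ E s ℓ → (E + E + 1) * s + E * ℓ ≡ E * (s + (ℓ + s)) + s
  expand = solve-∀

module _ {q : ℕ} {{_ : NonZero q}} where

  CandidateBound : ℕ → Word q → ℕ → Set
  CandidateBound n p m =
    length (candidates n p m) * D q (suc n) * q ^ ((2 ^ suc n ∸ 1) * length p) ≤ q ^ m

  -- The candidates with |φ(x₀)| = ℓ: q^ℓ choices of u, each completed by a
  -- candidate for the prefix p u p, which is longer by ℓ + |p|.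
  candidates-with-first-bound : ∀ k (p : Word q) m ℓ → 1 ≤ ℓ → ℓ ≤ m ∸ length p →
    (∀ p′ m′ → CandidateBound k p′ m′) →
    let E = 2 ^ suc k ∸ 1 in
    length (candidates-with-first k p m ℓ) * (D q (suc k) * q ^ ((E + E + 1) * length p)) * (q ^ E) ^ ℓ ≤ q ^ m
  candidates-with-first-bound k p m ℓ 1≤ℓ ℓ≤m∸s bound = begin
    length blk * (Dₖ * q ^ ((E + E + 1) * s)) * (q ^ E) ^ ℓ
      ≡⟨ shuffle (length blk) Dₖ _ _ ⟩
    length blk * Dₖ * (q ^ ((E + E + 1) * s) * (q ^ E) ^ ℓ)
      ≡⟨ cong (length blk * Dₖ *_) (exponent-split q E s ℓ) ⟩
    length blk * Dₖ * (q ^ (E * (s + (ℓ + s))) * q ^ s)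
      ≡⟨ shuffle (length blk) Dₖ _ _ ⟨
    length blk * (Dₖ * q ^ (E * (s + (ℓ + s)))) * q ^ s
      ≤⟨ *-monoˡ-≤ (q ^ s) all-u ⟩
    q ^ ℓ * q ^ m′ * q ^ s
      ≡⟨ cong (_* q ^ s) (^-distribˡ-+-* q ℓ m′) ⟨
    q ^ (ℓ + m′) * q ^ s
      ≡⟨ ^-distribˡ-+-* q (ℓ + m′) s ⟨
    q ^ (ℓ + m′ + s)
      ≡⟨ cong (q ^_) (trans (reorder ℓ m′ s) (m∸n+n≡m s+ℓ≤m)) ⟩
    q ^ m ∎
    where
    open ≤-Reasoning
    s   = length p
    E   = 2 ^ suc k ∸ 1
    Dₖ  = D q (suc k)
    m′  = m ∸ (s + ℓ)
    blk = candidates-with-first k p m ℓ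
    shuffle : ∀ x y z w → x * (y * z) * w ≡ x * y * (z * w)
    shuffle = solve-∀
    reorder : ∀ ℓ x s → ℓ + x + s ≡ x + (s + ℓ)
    reorder = solve-∀
    s≤m : s ≤ m
    s≤m = <⇒≤ (m∸n≢0⇒n<m (λ m∸s≡0 → n≮0 (≤-trans 1≤ℓ (subst (ℓ ≤_) m∸s≡0 ℓ≤m∸s))))
    s+ℓ≤m : s + ℓ ≤ m
    s+ℓ≤m = ≤-trans (+-monoʳ-≤ s ℓ≤m∸s) (≤-reflexive (m+[n∸m]≡n s≤m))
    one-u : ∀ {u} → u ∈ words q ℓ →
      length (map (λ V → V ++ p ++ u) (candidates k (p ++ u ++ p) m′)) * (Dₖ * q ^ (E * (s + (ℓ + s)))) ≤ q ^ m′
    one-u {u} u∈ = begin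
      length (map (λ V → V ++ p ++ u) (candidates k (p ++ u ++ p) m′)) * (Dₖ * q ^ (E * (s + (ℓ + s))))
        ≡⟨ cong (_* (Dₖ * q ^ (E * (s + (ℓ + s))))) (length-map (λ V → V ++ p ++ u) (candidates k (p ++ u ++ p) m′)) ⟩
      length (candidates k (p ++ u ++ p) m′) * (Dₖ * q ^ (E * (s + (ℓ + s))))
        ≡⟨ *-assoc (length (candidates k (p ++ u ++ p) m′)) Dₖ _ ⟨
      length (candidates k (p ++ u ++ p) m′) * Dₖ * q ^ (E * (s + (ℓ + s)))
        ≡⟨ cong (λ t → length (candidates k (p ++ u ++ p) m′) * Dₖ * q ^ (E * t)) |pup| ⟨
      length (candidates k (p ++ u ++ p) m′) * Dₖ * q ^ (E * length (p ++ u ++ p))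
        ≤⟨ bound (p ++ u ++ p) m′ ⟩
      q ^ m′ ∎
      where
      |pup| : length (p ++ u ++ p) ≡ s + (ℓ + s)
      |pup| = trans (length-++ p) (cong (s +_) (trans (length-++ u) (cong (_+ s) (∈words⇒length ℓ u∈))))
    all-u : length blk * (Dₖ * q ^ (E * (s + (ℓ + s)))) ≤ q ^ ℓ * q ^ m′
    all-u = subst (λ t → length blk * (Dₖ * q ^ (E * (s + (ℓ + s)))) ≤ t * q ^ m′) (length-words ℓ)
      (length-concatMap-≤ (λ u → map (λ V → V ++ p ++ u) (candidates k (p ++ u ++ p) m′)) (words q ℓ) _ _ one-u)

  -- Induction on n; the step sums candidates-with-first-bound over
  -- 1 ≤ ℓ ≤ m - |p| with blocks-geometric, which supplies the factor q^(2^(k+1)-1) - 1.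
  candidates-bound : ∀ n (p : Word q) m → CandidateBound n p m
  candidates-bound zero p m with length p <? m
  ... | yes s<m = ≤-reflexive (begin
    length (map (p ++_) (words q (m ∸ s))) * 1 * q ^ (1 * s)
      ≡⟨ cong₂ (λ a b → a * 1 * q ^ b) (trans (length-map (p ++_) (words q (m ∸ s))) (length-words (m ∸ s))) (*-identityˡ s) ⟩
    q ^ (m ∸ s) * 1 * q ^ s  ≡⟨ cong (_* q ^ s) (*-identityʳ (q ^ (m ∸ s))) ⟩
    q ^ (m ∸ s) * q ^ s      ≡⟨ ^-distribˡ-+-* q (m ∸ s) s ⟨
    q ^ (m ∸ s + s)          ≡⟨ cong (q ^_) (m∸n+n≡m (<⇒≤ s<m)) ⟩
    q ^ m                    ∎)
    where
    open ≡-Reasoning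
    s = length p
  ... | no _ = z≤n
  candidates-bound (suc k) p m = begin
    length C * D q (suc (suc k)) * q ^ ((2 ^ suc (suc k) ∸ 1) * s)
      ≡⟨ cong₂ (λ P e → length C * P * q ^ (e * s)) (prodFrom-snoc q 1 k) (2^suc∸1 (suc k)) ⟩
    length C * (Dₖ * (Q ∸ 1)) * q ^ ((E + E + 1) * s)
      ≡⟨ rearrange (length C) Dₖ (Q ∸ 1) _ ⟩
    length C * ((Q ∸ 1) * (Dₖ * q ^ ((E + E + 1) * s)))
      ≤⟨ blocks-geometric (candidates-with-first k p m) (Dₖ * q ^ ((E + E + 1) * s)) Q (q ^ m) (m ∸ s) (m^n>0 q E)
           (λ ℓ 1≤ℓ ℓ≤ → candidates-with-first-bound k p m ℓ 1≤ℓ ℓ≤ (candidates-bound k)) ⟩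
    q ^ m ∎
    where
    open ≤-Reasoning
    s = length p
    E = 2 ^ suc k ∸ 1
    Q = q ^ E
    Dₖ = D q (suc k)
    C = candidates (suc k) p m
    rearrange : ∀ c a d P → c * (a * d) * P ≡ c * (d * (a * P))
    rearrange = solve-∀

length-sandwich : ∀ {A : Set} (X M : List A) → length (X ++ M ++ X) ≡ length X + (length M + length X)
length-sandwich X M = trans (length-++ X) (cong (length X +_) (length-++ M))

module _ {q : ℕ} where

  ∈words-suc⇒nonempty : ∀ r {M : Word q} → M ∈ words q (suc r) → M ≢ []
  ∈words-suc⇒nonempty r M∈ refl = 0≢1+n (∈words⇒length (suc r) M∈)

  sandwich : Word q × Word q → Word q
  sandwich (A , M) = A ++ M ++ A

  sandwiches : List (Word q) → List (Word q) → List (Word q)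
  sandwiches As Ms = map sandwich (cartesianProduct As Ms)

  length-sandwiches : ∀ As Ms → length (sandwiches As Ms) ≡ length As * length Ms
  length-sandwiches As Ms = trans (length-map sandwich (cartesianProduct As Ms)) (length-cartesianProductWith _,_ As Ms)

  ∈-sandwiches⁻ : ∀ As Ms {W} → W ∈ sandwiches As Ms → ∃₂ λ A M → A ∈ As × M ∈ Ms × W ≡ A ++ M ++ A
  ∈-sandwiches⁻ As Ms W∈ with ∈-map⁻ sandwich W∈
  ... | (A , M) , AM∈ , refl with ∈-cartesianProduct⁻ As Ms AM∈
  ... | A∈ , M∈ = A , M , A∈ , M∈ , refl

  sandwiches-unique : ∀ As Ms → Unique As → Unique Ms →
    (∀ {A B} → A ∈ As → B ∈ As → length A ≡ length B) → Unique (sandwiches As Ms)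
  sandwiches-unique As Ms As-unique Ms-unique same-length =
    unique-map sandwich (cartesianProduct As Ms) (Unique.cartesianProduct⁺ As-unique Ms-unique) injective
    where
    injective : ∀ {x y} → x ∈ cartesianProduct As Ms → y ∈ cartesianProduct As Ms → sandwich x ≡ sandwich y → x ≡ y
    injective {A , M} {B , N} x∈ y∈ eq
      with ++-cancel-equal-length A B (M ++ A) (N ++ B)
             (same-length (proj₁ (∈-cartesianProduct⁻ As Ms x∈)) (proj₁ (∈-cartesianProduct⁻ As Ms y∈))) eq
    ... | refl , MA≡NA = cong (A ,_) (++-cancelʳ A M N MA≡NA)

  -- The instances of Zₖ mapping every variable to a single letter.
  letter-instances : ℕ → List (Word q)
  letter-instances zero    = [] ∷ []
  letter-instances (suc k) = sandwiches (letter-instances k) (words q 1)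

  letter-instances-length : ∀ k {A} → A ∈ letter-instances k → suc (length A) ≡ 2 ^ k
  letter-instances-length zero (here refl) = refl
  letter-instances-length (suc k) W∈ with ∈-sandwiches⁻ (letter-instances k) (words q 1) W∈
  ... | A , M , A∈ , M∈ , refl = begin
    suc (length (A ++ M ++ A))                     ≡⟨ cong suc (length-sandwich A M) ⟩
    suc (length A + (length M + length A))         ≡⟨ cong (λ r → suc (length A + (r + length A))) (∈words⇒length 1 M∈) ⟩
    suc (length A + (1 + length A))                ≡⟨ double (length A) ⟩
    suc (length A) + (suc (length A) + 0)          ≡⟨ cong (λ t → t + (t + 0)) (letter-instances-length k A∈) ⟩
    2 ^ suc k                                      ∎
    where
    open ≡-Reasoning
    double : ∀ a → suc (a + (1 + a)) ≡ suc a + (suc a + 0)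
    double = solve-∀

  -- There is one letter instance per assignment of letters to x₀ … x_{k-1}.
  letter-instances-count : ∀ k → length (letter-instances k) ≡ q ^ k
  letter-instances-count zero    = refl
  letter-instances-count (suc k) = begin
    length (sandwiches (letter-instances k) (words q 1)) ≡⟨ length-sandwiches (letter-instances k) (words q 1) ⟩
    length (letter-instances k) * length (words q 1)    ≡⟨ cong₂ _*_ (letter-instances-count k) (length-words {q} 1) ⟩
    q ^ k * (q * 1)                                      ≡⟨ cong (q ^ k *_) (*-identityʳ q) ⟩
    q ^ k * q                                            ≡⟨ *-comm (q ^ k) q ⟩
    q ^ suc k                                            ∎
    where open ≡-Reasoning

  letter-instances-unique : ∀ k → Unique (letter-instances k)
  letter-instances-unique zero    = [] ∷ []
  letter-instances-unique (suc k) =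
    sandwiches-unique (letter-instances k) (words q 1) (letter-instances-unique k) (words-unique 1)
      (λ A∈ B∈ → suc-injective (trans (letter-instances-length k A∈) (sym (letter-instances-length k B∈))))

  sandwiches-instance : ∀ k As Ms → (∀ {A} → A ∈ As → IsInstance (Z k) A) → (∀ {M} → M ∈ Ms → M ≢ []) →
    ∀ {W} → W ∈ sandwiches As Ms → IsInstance (Z (suc k)) W
  sandwiches-instance k As Ms As-instances Ms-nonempty W∈ with ∈-sandwiches⁻ As Ms W∈
  ... | A , M , A∈ , M∈ , refl = sandwich-instance k (As-instances A∈) (Ms-nonempty M∈)

  letter-instances-instance : ∀ k {A} → A ∈ letter-instances k → IsInstance (Z k) A
  letter-instances-instance zero    (here refl) = (λ ()) , (λ ()) , refl
  letter-instances-instance (suc k) =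
    sandwiches-instance k (letter-instances k) (words q 1) (letter-instances-instance k) (∈words-suc⇒nonempty 0)

module _ {q : ℕ} {{_ : NonZero q}} where

  -- Upper count: every instance of Zₙ₊₁ of length m is a candidate for the
  -- empty prefix, and the instances occur without repetition.
  instances-upper : ∀ n (dec : InstanceDecider (Z (suc n)) q) m →
    countInstances (Z (suc n)) q dec m * D q (suc n) ≤ q ^ m
  instances-upper n dec m = begin
    countInstances (Z (suc n)) q dec m * D q (suc n) ≤⟨ *-monoˡ-≤ (D q (suc n)) count≤candidates ⟩
    length C * D q (suc n)                           ≡⟨ *-identityʳ (length C * D q (suc n)) ⟨
    length C * D q (suc n) * 1                       ≡⟨ cong (λ e → length C * D q (suc n) * q ^ e) (*-zeroʳ (2 ^ suc n ∸ 1)) ⟨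
    length C * D q (suc n) * q ^ ((2 ^ suc n ∸ 1) * 0) ≤⟨ candidates-bound n [] m ⟩
    q ^ m ∎
    where
    open ≤-Reasoning
    C = candidates n [] m
    instances⊆C : ∀ {W} → W ∈ filter dec (words q m) → W ∈ C
    instances⊆C W∈ with ∈-filter⁻ dec W∈
    ... | W∈words , (φ , φ-nonerasing , refl) =
      candidates-cover n [] φ φ-nonerasing m (∈words⇒length m W∈words)
    count≤candidates : countInstances (Z (suc n)) q dec m ≤ length C
    count≤candidates = unique-⊆-length (filter dec (words q m)) C (Unique.filter⁺ dec (words-unique m)) instances⊆C

  -- Lower count: for m = 2^(k+1) + d the words A M A with A a letter instance
  -- of Zₖ and |M| = d + 2 are q^(k+d+2) distinct instances of Zₖ₊₁ of length m.
  instances-lower : ∀ k (dec : InstanceDecider (Z (suc k)) q) m → 2 ^ suc k ≤ m →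
    q ^ m ≤ countInstances (Z (suc k)) q dec m * q ^ (2 ^ suc k ∸ suc k ∸ 1)
  instances-lower k dec m T≤m = begin
    q ^ m                   ≤⟨ ^-monoʳ-≤ q m≤k+r+e ⟩
    q ^ (k + r + e)         ≡⟨ trans (^-distribˡ-+-* q (k + r) e) (cong (_* q ^ e) (^-distribˡ-+-* q k r)) ⟩
    q ^ k * q ^ r * q ^ e   ≡⟨ cong (_* q ^ e) count-long ⟨
    length long * q ^ e     ≤⟨ *-monoˡ-≤ (q ^ e) (unique-⊆-length long (filter dec (words q m)) long-unique long⊆instances) ⟩
    countInstances (Z (suc k)) q dec m * q ^ e ∎
    where
    open ≤-Reasoning
    T = 2 ^ suc k
    d = m ∸ T
    r = suc (suc d)
    e = T ∸ suc k ∸ 1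
    long = sandwiches (letter-instances k) (words q r)
    m≡T+d : m ≡ T + d
    m≡T+d = sym (m+[n∸m]≡n T≤m)
    m≤k+r+e : m ≤ k + r + e
    m≤k+r+e = begin
      m                             ≡⟨ m≡T+d ⟩
      T + d                         ≤⟨ +-monoˡ-≤ d (m≤n+m∸n T (suc k + 1)) ⟩
      suc k + 1 + (T ∸ (suc k + 1)) + d ≡⟨ cong (λ t → suc k + 1 + t + d) (∸-+-assoc T (suc k) 1) ⟨
      suc k + 1 + e + d             ≡⟨ reorder k e d ⟩
      k + r + e                     ∎
      where
      reorder : ∀ k e d → suc k + 1 + e + d ≡ k + suc (suc d) + e
      reorder = solve-∀
    count-long : length long ≡ q ^ k * q ^ r
    count-long = trans (length-sandwiches (letter-instances k) (words q r))
      (cong₂ _*_ (letter-instances-count k) (length-words {q} r))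
    long-unique : Unique long
    long-unique = sandwiches-unique (letter-instances k) (words q r) (letter-instances-unique k) (words-unique r)
      (λ A∈ B∈ → suc-injective (trans (letter-instances-length k A∈) (sym (letter-instances-length k B∈))))
    length-long : ∀ {W} → W ∈ long → length W ≡ m
    length-long W∈ with ∈-sandwiches⁻ (letter-instances k) (words q r) W∈
    ... | A , M , A∈ , M∈ , refl = begin-equality
      length (A ++ M ++ A)                   ≡⟨ length-sandwich A M ⟩
      length A + (length M + length A)       ≡⟨ cong (λ t → length A + (t + length A)) (∈words⇒length r M∈) ⟩
      length A + (r + length A)              ≡⟨ regroup (length A) d ⟩
      suc (length A) + (suc (length A) + 0) + d ≡⟨ cong (λ t → t + (t + 0) + d) (letter-instances-length k A∈) ⟩
      T + d                                  ≡⟨ m≡T+d ⟨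
      m                                      ∎
      where
      regroup : ∀ a d → a + (suc (suc d) + a) ≡ suc a + (suc a + 0) + d
      regroup = solve-∀
    long⊆instances : ∀ {W} → W ∈ long → W ∈ filter dec (words q m)
    long⊆instances {W} W∈ = ∈-filter⁺ dec (subst (λ l → W ∈ words q l) (length-long W∈) (∈words W))
      (sandwiches-instance k (letter-instances k) (words q r) (letter-instances-instance k) (∈words-suc⇒nonempty (suc d)) W∈)

fraction-≤ : ∀ a b c d .{{_ : NonZero b}} .{{_ : NonZero d}} → a * d ≤ c * b →
  (ℤ.+ a / b) ≤ℚ (ℤ.+ c / d)
fraction-≤ a (suc b) c (suc d) ad≤cb = ℚP.toℚᵘ-cancel-≤
  (ℚᵘP.≤-respˡ-≃ (ℚᵘP.≃-sym (ℚP.toℚᵘ-fromℚᵘ (ℚᵘ.mkℚᵘ (ℤ.+ a) b)))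
  (ℚᵘP.≤-respʳ-≃ (ℚᵘP.≃-sym (ℚP.toℚᵘ-fromℚᵘ (ℚᵘ.mkℚᵘ (ℤ.+ c) d)))
  (ℚᵘ.*≤* (subst₂ ℤ._≤_ (ℤP.pos-* a (suc d)) (ℤP.pos-* c (suc b)) (ℤ.+≤+ ad≤cb)))))

eventually-≥⇒LimGeq : (s : ℕ → ℚ) (L : ℚ) (N : ℕ) → (∀ m → N ≤ m → L ≤ℚ s m) → LimGeq s L
eventually-≥⇒LimGeq s L N L≤s ε ε>0 = N , λ m N≤m → ℚP.≤-trans (L-ε≤L) (L≤s m N≤m)
  where
  L-ε≤L : L - ε ≤ℚ L
  L-ε≤L = subst (L - ε ≤ℚ_) (ℚP.+-identityʳ L) (ℚP.+-monoʳ-≤ L (ℚP.neg-antimono-≤ (ℚP.<⇒≤ ε>0)))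

bounded-≤⇒LimLeq : (s : ℕ → ℚ) (U : ℚ) → (∀ m → s m ≤ℚ U) → LimLeq s U
bounded-≤⇒LimLeq s U s≤U ε ε>0 = 0 , λ m _ → ℚP.≤-trans (s≤U m) U≤U+ε
  where
  U≤U+ε : U ≤ℚ U +ℚ ε
  U≤U+ε = subst (_≤ℚ U +ℚ ε) (ℚP.+-identityʳ U) (ℚP.+-monoʳ-≤ U (ℚP.<⇒≤ ε>0))

corollary2p2 : (n q : ℕ) → 1 ≤ n → (h : 2 ≤ q) → (dec : InstanceDecider (Z n) q) →
  LimGeq (I_ (Z n) q h dec) (lowerBound q h n) × LimLeq (I_ (Z n) q h dec) (upperBound q h n)
corollary2p2 (suc k) q _ h dec = lower , upper
  where
  instance
    q≢0 : NonZero q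
    q≢0 = nonZero-q q h
  count = countInstances (Z (suc k)) q dec
  e = 2 ^ suc k ∸ suc k ∸ 1
  lower : LimGeq (I_ (Z (suc k)) q h dec) (lowerBound q h (suc k))
  lower = eventually-≥⇒LimGeq _ _ (2 ^ suc k) λ m T≤m →
    fraction-≤ 1 (q ^ e) (count m) (q ^ m) {{m^n≢0 q e}} {{m^n≢0 q m}}
      (subst (_≤ count m * q ^ e) (sym (*-identityˡ (q ^ m))) (instances-lower k dec m T≤m))
  upper : LimLeq (I_ (Z (suc k)) q h dec) (upperBound q h (suc k))
  upper = bounded-≤⇒LimLeq _ _ λ m →
    fraction-≤ (count m) (q ^ m) 1 (D q (suc k)) {{m^n≢0 q m}} {{prodFrom-pos q 1 k h (s≤s z≤n)}}
      (subst (count m * D q (suc k) ≤_) (sym (*-identityˡ (q ^ m))) (instances-upper k dec m))
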